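{- Let $(X,\mathcal{B})$ be a simple $(v,k,\lambda)$-BIBD and suppose that $\mathcal{B} \cup \{\emptyset\}$ is a group under the symmetric difference $\Delta$ (that is, it is a subgroup of $(\mathcal{P}(X),\Delta)$: for all $B, C \in \mathcal{B}\cup\{\emptyset\}$ one has $B \Delta C \in \mathcal{B}\cup\{\emptyset\}$). Then $(X,\mathcal{B})$ is a symmetric $(4\lambda - 1, 2\lambda, \lambda)$-BIBD.
   Context: A simple $(v,k,\lambda)$-BIBD is a pair $(X,\mathcal{B})$ where $X$ is a finite set of $v$ points and $\mathcal{B}$ is a set of (pairwise distinct) subsets of $X$, called blocks, each containing exactly $k$ points, such that every pair of distinct points is contained in exactly $\lambda$ blocks; it is required that $v > k \geq 2$. The design is symmetric if the number of blocks equals the number of points $v$ (equivalently, any two distinct blocks meet in a constant number of points). $\mathcal{P}(X)$ denotes the power set of $X$, and $B \Delta C = (B\setminus C)\cup(C\setminus B)$. -}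

module Defs where

open import Data.Nat using (ℕ; _<_; _≤_; _+_; _*_)
open import Data.Fin using (Fin)
open import Data.Fin.Subset using (Subset; _∪_; _─_; ∣_∣; ⊥) renaming (_∈_ to _∈ₛ_)
open import Data.Fin.Subset.Properties using (_∈?_)
open import Data.List using (List; length; filter)
open import Data.List.Membership.Propositional using () renaming (_∈_ to _∈ₗ_)
open import Data.List.Relation.Unary.Unique.Propositional using (Unique)
open import Data.Product using (_×_)
open import Data.Sum using (_⊎_)
open import Relation.Nullary using (¬_)
open import Relation.Nullary.Decidable using (_×-dec_)
open import Relation.Binary.PropositionalEquality using (_≡_)

-- Point set X = Fin v; a block is a subset of Fin v; the block collection is a
-- duplicate-free list of subsets (i.e. a finite set of subsets).

_Δ_ : ∀ {n} → Subset n → Subset n → Subset n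
B Δ C = (B ─ C) ∪ (C ─ B)

pairCount : ∀ {v} → List (Subset v) → Fin v → Fin v → ℕ
pairCount ℬ x y = length (filter (λ B → (x ∈? B) ×-dec (y ∈? B)) ℬ)

record IsSimpleBIBD (v k lam : ℕ) (ℬ : List (Subset v)) : Set where
  field
    v>k      : k < v
    k≥2      : 2 ≤ k
    distinct : Unique ℬ
    blockSize : ∀ {B} → B ∈ₗ ℬ → ∣ B ∣ ≡ k
    balanced : ∀ (x y : Fin v) → ¬ (x ≡ y) → pairCount ℬ x y ≡ lam

_∈ℬ∅_ : ∀ {v} → Subset v → List (Subset v) → Set
B ∈ℬ∅ ℬ = (B ∈ₗ ℬ) ⊎ (B ≡ ⊥)

ClosedUnderΔ : ∀ {v} → List (Subset v) → Set
ClosedUnderΔ ℬ = ∀ {B C} → B ∈ℬ∅ ℬ → C ∈ℬ∅ ℬ → (B Δ C) ∈ℬ∅ ℬ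

IsSymmetric : ∀ {v} → List (Subset v) → Set
IsSymmetric {v} ℬ = length ℬ ≡ v

-- G = ℬ ∪ {∅} is an elementary abelian 2-group acting on itself by the translations C ↦ A Δ C,
-- and a translation by a block A flips exactly the points of A. Counting the elements of G by
-- their intersection pattern with a point x, resp. a pair {x, y}, a translation by a block
-- through x shows that half of G contains x, and translations by a block through x but not y
-- and by a block through both show that the four patterns on {x, y} are equally frequent.
-- Hence every point lies on r = 2λ blocks and |G| = b + 1 = 4λ. The standard identities
-- r(k - 1) = λ(v - 1) and vr = bk then give v = 2k - 1 and k = 2λ, so b = v = 4λ - 1.
module Submission where

open import Defs
open import Data.Bool using (Bool; true; false; not; _∧_; _xor_)
open import Data.Bool.Properties using (∧-idem; not-involutive)
open import Data.Fin using (Fin; zero; suc; punchIn; fromℕ<)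
open import Data.Fin.Properties using (punchInᵢ≢i)
open import Data.Fin.Subset using (Subset; ∣_∣; inside; outside) renaming (⊥ to ∅)
open import Data.Fin.Subset.Properties using (_∈?_; ∣⊥∣≡0)
open import Data.List using (List; []; _∷_; length; map; filter)
open import Data.List.Membership.Propositional using (_∈_)
open import Data.List.Membership.Propositional.Properties using (∈-map⁺; ∈-map⁻)
open import Data.List.Membership.Propositional.Properties.WithK using (unique∧set⇒bag)
open import Data.List.Properties using (map-cong; map-cong-local; map-∘)
open import Data.List.Relation.Binary.BagAndSetEquality using (∼bag⇒↭)
open import Data.List.Relation.Binary.Permutation.Propositional using (_↭_)
open import Data.List.Relation.Binary.Permutation.Propositional.Properties using (map⁺)
open import Data.List.Relation.Unary.All as All using ()
open import Data.List.Relation.Unary.Any using (here; there)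
open import Data.List.Relation.Unary.Unique.Propositional using (Unique)
import Data.List.Relation.Unary.Unique.Propositional.Properties as Unique
open import Data.List.Relation.Unary.AllPairs using (_∷_)
open import Data.Nat using (ℕ; zero; suc; _+_; _*_; _≤_; _<_; z≤n; s≤s; >-nonZero)
open import Data.Nat.ListAction using (sum)
open import Data.Nat.ListAction.Properties using (sum-↭)
open import Data.Nat.Properties
open import Algebra.Properties.Semiring.Sum +-*-semiring
  using (sum-syntax; sum-cong-≗; sum-replicate-zero; sum-remove; ∑-distrib-+; *-distribˡ-sum)
open import Data.Nat.Tactic.RingSolver using (solve-∀)
open import Data.Product using (_×_; _,_; ∃-syntax)
open import Data.Sum using (inj₁; inj₂)
open import Data.Vec using ([]; _∷_; lookup)
open import Data.Vec.Properties using (lookup-replicate)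
open import Function using (_∘_)
open import Function.Bundles using (mk⇔)
open import Relation.Nullary using (¬_; Dec; does)
open import Relation.Binary.PropositionalEquality

private
  variable
    A : Set
    n : ℕ

toℕ : Bool → ℕ
toℕ true  = 1
toℕ false = 0

toℕ-∧ : ∀ a b → toℕ (a ∧ b) ≡ toℕ a * toℕ b
toℕ-∧ true  b = sym (+-identityʳ (toℕ b))
toℕ-∧ false b = refl

toℕ-split : ∀ a b → toℕ a ≡ toℕ (a ∧ b) + toℕ (a ∧ not b)
toℕ-split true  true  = refl
toℕ-split true  false = refl
toℕ-split false b     = refl

∧≡true : ∀ {a b} → a ∧ b ≡ true → a ≡ true × b ≡ true
∧≡true {true} {true} _ = refl , refl

sum-map-+ : ∀ (f g : A → ℕ) xs → sum (map (λ z → f z + g z) xs) ≡ sum (map f xs) + sum (map g xs)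
sum-map-+ f g []       = refl
sum-map-+ f g (x ∷ xs) = begin
  f x + g x + sum (map (λ z → f z + g z) xs)   ≡⟨ cong (f x + g x +_) (sum-map-+ f g xs) ⟩
  f x + g x + (sum (map f xs) + sum (map g xs)) ≡⟨ +-+-comm (f x) (g x) _ _ ⟩
  f x + sum (map f xs) + (g x + sum (map g xs)) ∎
  where
  open ≡-Reasoning
  +-+-comm : ∀ a b c d → a + b + (c + d) ≡ a + c + (b + d)
  +-+-comm = solve-∀

sum-map-*ʳ : ∀ (f : A → ℕ) c xs → sum (map (λ z → f z * c) xs) ≡ sum (map f xs) * c
sum-map-*ʳ f c []       = refl
sum-map-*ʳ f c (x ∷ xs) = trans (cong (f x * c +_) (sum-map-*ʳ f c xs)) (sym (*-distribʳ-+ c (f x) _))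

sum-map-const : ∀ c (xs : List A) → sum (map (λ _ → c) xs) ≡ length xs * c
sum-map-const c []       = refl
sum-map-const c (x ∷ xs) = cong (c +_) (sum-map-const c xs)

sum-map-∑ : ∀ (f : A → Fin n → ℕ) xs →
  sum (map (λ z → ∑[ i < n ] f z i) xs) ≡ ∑[ i < n ] sum (map (λ z → f z i) xs)
sum-map-∑ {n = n} f []       = sym (sum-replicate-zero n)
sum-map-∑         f (x ∷ xs) = trans (cong (_ +_) (sum-map-∑ f xs)) (sym (∑-distrib-+ (f x) _))

count : (A → Bool) → List A → ℕ
count p xs = sum (map (toℕ ∘ p) xs)

count-cong : ∀ {p q : A → Bool} → (∀ z → p z ≡ q z) → ∀ xs → count p xs ≡ count q xs
count-cong p≗q xs = cong sum (map-cong (cong toℕ ∘ p≗q) xs)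

count-↭ : ∀ (p : A → Bool) {xs ys} → xs ↭ ys → count p xs ≡ count p ys
count-↭ p xs↭ys = sum-↭ (map⁺ (toℕ ∘ p) xs↭ys)

count-map : ∀ {A′ : Set} (p : A → Bool) (f : A′ → A) xs → count p (map f xs) ≡ count (p ∘ f) xs
count-map p f xs = cong sum (sym (map-∘ xs))

count-split : ∀ (p q : A → Bool) xs →
  count p xs ≡ count (λ z → p z ∧ q z) xs + count (λ z → p z ∧ not (q z)) xs
count-split p q xs =
  trans (cong sum (map-cong (λ z → toℕ-split (p z) (q z)) xs)) (sum-map-+ _ _ xs)

count-∷-reject : ∀ (p : A → Bool) z xs → p z ≡ false → count p (z ∷ xs) ≡ count p xs
count-∷-reject p z xs pz = cong (λ b → toℕ b + count p xs) pz

count-true : ∀ (xs : List A) → count (λ _ → true) xs ≡ length xs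
count-true xs = trans (sum-map-const 1 xs) (*-identityʳ (length xs))

count-positive : ∀ (p : A → Bool) xs → 1 ≤ count p xs → ∃[ z ] z ∈ xs × p z ≡ true
count-positive p (x ∷ xs) h with p x in px
... | true  = x , here refl , px
... | false with z , z∈xs , pz ← count-positive p xs h = z , there z∈xs , pz

length-filter : ∀ {P : A → Set} (P? : ∀ z → Dec (P z)) xs →
  length (filter P? xs) ≡ count (does ∘ P?) xs
length-filter P? []       = refl
length-filter P? (x ∷ xs) with does (P? x)
... | true  = cong suc (length-filter P? xs)
... | false = length-filter P? xs

map-involution-↭ : ∀ {f : A → A} {xs} → (∀ z → f (f z) ≡ z) → Unique xs →
  (∀ {z} → z ∈ xs → f z ∈ xs) → map f xs ↭ xs
map-involution-↭ {f = f} {xs} ff≡id unique f∈ =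
  ∼bag⇒↭ (unique∧set⇒bag (Unique.map⁺ injective unique) unique (mk⇔ to from))
  where
  injective : ∀ {y z} → f y ≡ f z → y ≡ z
  injective {y} {z} fy≡fz = trans (sym (ff≡id y)) (trans (cong f fy≡fz) (ff≡id z))
  to : ∀ {z} → z ∈ map f xs → z ∈ xs
  to z∈ with y , y∈xs , refl ← ∈-map⁻ f z∈ = f∈ y∈xs
  from : ∀ {z} → z ∈ xs → z ∈ map f xs
  from {z} z∈xs = subst (_∈ map f xs) (ff≡id z) (∈-map⁺ f (f∈ z∈xs))

∑-const : ∀ n c → ∑[ i < n ] c ≡ n * c
∑-const zero    c = refl
∑-const (suc n) c = cong (c +_) (∑-const n c)

∑-pointed : ∀ (f : Fin n → ℕ) x {c} → (∀ y → y ≢ x → f y ≡ c) →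
  ∑[ y < n ] f y + c ≡ f x + n * c
∑-pointed {n = suc n} f x {c} f≡c = begin
  ∑[ y < suc n ] f y + c               ≡⟨ cong (_+ c) (sum-remove {i = x} f) ⟩
  f x + ∑[ j < n ] f (punchIn x j) + c ≡⟨ cong (λ s → f x + s + c) (sum-cong-≗ (λ j → f≡c _ (punchInᵢ≢i x j))) ⟩
  f x + ∑[ j < n ] c + c               ≡⟨ cong (λ s → f x + s + c) (∑-const n c) ⟩
  f x + n * c + c                      ≡⟨ rearrange (f x) (n * c) c ⟩
  f x + suc n * c                      ∎
  where
  open ≡-Reasoning
  rearrange : ∀ a b c → a + b + c ≡ a + (c + b)
  rearrange = solve-∀

∣p∣≡∑ : ∀ (p : Subset n) → ∣ p ∣ ≡ ∑[ i < n ] toℕ (lookup p i)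
∣p∣≡∑ []            = refl
∣p∣≡∑ (inside  ∷ p) = cong suc (∣p∣≡∑ p)
∣p∣≡∑ (outside ∷ p) = ∣p∣≡∑ p

∣p∣<n⇒∃∉ : ∀ (p : Subset n) → ∣ p ∣ < n → ∃[ y ] lookup p y ≡ false
∣p∣<n⇒∃∉ (outside ∷ p) _       = zero , refl
∣p∣<n⇒∃∉ (inside  ∷ p) (s≤s h) with y , y∉p ← ∣p∣<n⇒∃∉ p h = suc y , y∉p

∈∉⇒≢ : ∀ (p : Subset n) {x y} → lookup p x ≡ true → lookup p y ≡ false → x ≢ y
∈∉⇒≢ p x∈p y∉p refl with () ← trans (sym x∈p) y∉p

∈?-does : ∀ (x : Fin n) p → does (x ∈? p) ≡ lookup p x
∈?-does zero    (inside  ∷ p) = refl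
∈?-does zero    (outside ∷ p) = refl
∈?-does (suc x) (_ ∷ p)       = ∈?-does x p

lookup-Δ : ∀ (p q : Subset n) i → lookup (p Δ q) i ≡ lookup p i xor lookup q i
lookup-Δ (inside  ∷ p) (inside  ∷ q) zero    = refl
lookup-Δ (inside  ∷ p) (outside ∷ q) zero    = refl
lookup-Δ (outside ∷ p) (inside  ∷ q) zero    = refl
lookup-Δ (outside ∷ p) (outside ∷ q) zero    = refl
lookup-Δ (_ ∷ p)       (_ ∷ q)       (suc i) = lookup-Δ p q i

lookup-Δ-inside : ∀ (p q : Subset n) {i} → lookup p i ≡ true → lookup (p Δ q) i ≡ not (lookup q i)
lookup-Δ-inside p q {i} i∈p = trans (lookup-Δ p q i) (cong (_xor lookup q i) i∈p)

lookup-Δ-outside : ∀ (p q : Subset n) {i} → lookup p i ≡ false → lookup (p Δ q) i ≡ lookup q i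
lookup-Δ-outside p q {i} i∉p = trans (lookup-Δ p q i) (cong (_xor lookup q i) i∉p)

Δ-involutive : ∀ (p q : Subset n) → p Δ (p Δ q) ≡ q
Δ-involutive []            []            = refl
Δ-involutive (inside  ∷ p) (inside  ∷ q) = cong (inside  ∷_) (Δ-involutive p q)
Δ-involutive (inside  ∷ p) (outside ∷ q) = cong (outside ∷_) (Δ-involutive p q)
Δ-involutive (outside ∷ p) (inside  ∷ q) = cong (inside  ∷_) (Δ-involutive p q)
Δ-involutive (outside ∷ p) (outside ∷ q) = cong (outside ∷_) (Δ-involutive p q)

replication : ∀ {v} → List (Subset v) → Fin v → ℕ
replication ℬ x = count (λ B → lookup B x) ℬ

pairCount≡count : ∀ {v} (ℬ : List (Subset v)) x y →
  pairCount ℬ x y ≡ count (λ B → lookup B x ∧ lookup B y) ℬ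
pairCount≡count ℬ x y = trans (length-filter _ ℬ)
  (count-cong (λ B → cong₂ _∧_ (∈?-does x B) (∈?-does y B)) ℬ)

module BIBD {v k lam} {ℬ : List (Subset v)} (bibd : IsSimpleBIBD v k lam ℬ) where
  open IsSimpleBIBD bibd

  pairs≡λ : ∀ x y → x ≢ y → count (λ B → lookup B x ∧ lookup B y) ℬ ≡ lam
  pairs≡λ x y x≢y = trans (sym (pairCount≡count ℬ x y)) (balanced x y x≢y)

  private
    sum-map-size : ∀ (f : Subset v → ℕ → ℕ) → sum (map (λ B → f B ∣ B ∣) ℬ) ≡ sum (map (λ B → f B k) ℬ)
    sum-map-size f = cong sum (map-cong-local (All.tabulate (cong (f _) ∘ blockSize)))

  ∑replication≡bk : ∑[ x < v ] replication ℬ x ≡ length ℬ * k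
  ∑replication≡bk = begin
    ∑[ x < v ] replication ℬ x                         ≡⟨ sum-map-∑ (λ B x → toℕ (lookup B x)) ℬ ⟨
    sum (map (λ B → ∑[ x < v ] toℕ (lookup B x)) ℬ)   ≡⟨ cong sum (map-cong ∣p∣≡∑ ℬ) ⟨
    sum (map ∣_∣ ℬ)                                    ≡⟨ sum-map-size (λ _ s → s) ⟩
    sum (map (λ _ → k) ℬ)                              ≡⟨ sum-map-const k ℬ ⟩
    length ℬ * k                                       ∎
    where open ≡-Reasoning

  -- r(k - 1) = λ(v - 1), rearranged so that no subtraction occurs.
  replication-identity : ∀ x → replication ℬ x * k + lam ≡ replication ℬ x + v * lam
  replication-identity x = begin
    replication ℬ x * k + lam                                   ≡⟨ cong (_+ lam) (sum-map-*ʳ _ k ℬ) ⟨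
    sum (map (λ B → toℕ (lookup B x) * k) ℬ) + lam             ≡⟨ cong (_+ lam) (sum-map-size (λ B s → toℕ (lookup B x) * s)) ⟨
    sum (map (λ B → toℕ (lookup B x) * ∣ B ∣) ℬ) + lam         ≡⟨ cong (_+ lam) (cong sum (map-cong through-x ℬ)) ⟩
    sum (map (λ B → ∑[ y < v ] toℕ (lookup B x ∧ lookup B y)) ℬ) + lam ≡⟨ cong (_+ lam) (sum-map-∑ (λ B y → toℕ (lookup B x ∧ lookup B y)) ℬ) ⟩
    ∑[ y < v ] count (λ B → lookup B x ∧ lookup B y) ℬ + lam  ≡⟨ ∑-pointed _ x (λ y y≢x → pairs≡λ x y (y≢x ∘ sym)) ⟩
    count (λ B → lookup B x ∧ lookup B x) ℬ + v * lam          ≡⟨ cong (_+ v * lam) (count-cong (λ B → ∧-idem (lookup B x)) ℬ) ⟩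
    replication ℬ x + v * lam                                   ∎
    where
    open ≡-Reasoning
    through-x : ∀ B → toℕ (lookup B x) * ∣ B ∣ ≡ ∑[ y < v ] toℕ (lookup B x ∧ lookup B y)
    through-x B = begin
      toℕ (lookup B x) * ∣ B ∣                                ≡⟨ cong (toℕ (lookup B x) *_) (∣p∣≡∑ B) ⟩
      toℕ (lookup B x) * ∑[ y < v ] toℕ (lookup B y)          ≡⟨ *-distribˡ-sum (toℕ (lookup B x)) (λ y → toℕ (lookup B y)) ⟩
      ∑[ y < v ] (toℕ (lookup B x) * toℕ (lookup B y))        ≡⟨ sum-cong-≗ (λ y → toℕ-∧ (lookup B x) (lookup B y)) ⟨
      ∑[ y < v ] toℕ (lookup B x ∧ lookup B y)                ∎

  replication-constant : ∀ {r} → (∀ x → replication ℬ x ≡ r) → v * r ≡ length ℬ * k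
  replication-constant {r} r-const = begin
    v * r                       ≡⟨ ∑-const v r ⟨
    ∑[ x < v ] r                ≡⟨ sum-cong-≗ (sym ∘ r-const) ⟩
    ∑[ x < v ] replication ℬ x ≡⟨ ∑replication≡bk ⟩
    length ℬ * k                ∎
    where open ≡-Reasoning

∃≢ : 2 ≤ n → (x : Fin n) → ∃[ y ] y ≢ x
∃≢ {n = suc zero}    (s≤s ()) _
∃≢ {n = suc (suc _)} _ x = punchIn x zero , punchInᵢ≢i x zero

module GroupDesign {v k lam} {ℬ : List (Subset v)}
  (lam≥1 : 1 ≤ lam) (bibd : IsSimpleBIBD v k lam ℬ) (closed : ClosedUnderΔ ℬ) where
  open IsSimpleBIBD bibd
  open BIBD bibd

  G : List (Subset v)
  G = ∅ ∷ ℬ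

  ∅∉ℬ : ¬ (∅ ∈ ℬ)
  ∅∉ℬ ∅∈ℬ with () ← subst (2 ≤_) (trans (sym (blockSize ∅∈ℬ)) (∣⊥∣≡0 v)) k≥2

  unique-G : Unique G
  unique-G = All.tabulate (λ B∈ℬ ∅≡B → ∅∉ℬ (subst (_∈ ℬ) (sym ∅≡B) B∈ℬ)) ∷ distinct

  Δ-closed : ∀ {A C} → A ∈ ℬ → C ∈ G → A Δ C ∈ G
  Δ-closed A∈ℬ C∈G = to-G (closed (inj₁ A∈ℬ) (from-G C∈G))
    where
    from-G : ∀ {C} → C ∈ G → C ∈ℬ∅ ℬ
    from-G (here refl)  = inj₂ refl
    from-G (there C∈ℬ) = inj₁ C∈ℬ
    to-G : ∀ {C} → C ∈ℬ∅ ℬ → C ∈ G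
    to-G (inj₁ C∈ℬ) = there C∈ℬ
    to-G (inj₂ refl) = here refl

  count-translate : ∀ {A} → A ∈ ℬ → (p q : Subset v → Bool) → (∀ C → p (A Δ C) ≡ q C) →
    count p G ≡ count q G
  count-translate {A} A∈ℬ p q p∘AΔ≗q = begin
    count p G              ≡⟨ count-↭ p (map-involution-↭ (Δ-involutive A) unique-G (Δ-closed A∈ℬ)) ⟨
    count p (map (A Δ_) G) ≡⟨ count-map p (A Δ_) G ⟩
    count (p ∘ (A Δ_)) G   ≡⟨ count-cong p∘AΔ≗q G ⟩
    count q G              ∎
    where open ≡-Reasoning

  replication-G : ∀ x → count (λ C → lookup C x) G ≡ replication ℬ x
  replication-G x = count-∷-reject (λ C → lookup C x) ∅ ℬ (lookup-replicate x false)

  pairs-G : ∀ x y → x ≢ y → count (λ C → lookup C x ∧ lookup C y) G ≡ lam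
  pairs-G x y x≢y = trans
    (count-∷-reject (λ C → lookup C x ∧ lookup C y) ∅ ℬ (cong (_∧ lookup ∅ y) (lookup-replicate x false)))
    (pairs≡λ x y x≢y)

  block-through : ∀ x y → x ≢ y → ∃[ A ] A ∈ ℬ × lookup A x ≡ true × lookup A y ≡ true
  block-through x y x≢y
    with A , A∈ℬ , x,y∈A ← count-positive _ ℬ (subst (1 ≤_) (sym (pairs≡λ x y x≢y)) lam≥1)
    = A , A∈ℬ , ∧≡true x,y∈A

  block-containing : ∀ x → ∃[ A ] A ∈ ℬ × lookup A x ≡ true
  block-containing x with x′ , x′≢x ← ∃≢ (≤-trans k≥2 (<⇒≤ v>k)) x
    with A , A∈ℬ , x∈A , _ ← block-through x x′ (x′≢x ∘ sym) = A , A∈ℬ , x∈A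

  |G|≡2r : ∀ x → suc (length ℬ) ≡ replication ℬ x + replication ℬ x
  |G|≡2r x with A , A∈ℬ , x∈A ← block-containing x = begin
    suc (length ℬ)                                ≡⟨ count-true G ⟨
    count (λ _ → true) G                          ≡⟨ count-split (λ _ → true) (λ C → lookup C x) G ⟩
    count (λ C → lookup C x) G + count (λ C → not (lookup C x)) G
      ≡⟨ cong (count (λ C → lookup C x) G +_) (count-translate A∈ℬ _ _ (λ C → lookup-Δ-inside A C x∈A)) ⟨
    count (λ C → lookup C x) G + count (λ C → lookup C x) G ≡⟨ cong₂ _+_ (replication-G x) (replication-G x) ⟩
    replication ℬ x + replication ℬ x            ∎
    where open ≡-Reasoning

  replication≡2λ : ∀ x → replication ℬ x ≡ lam + lam
  replication≡2λ x
    with A₀ , A₀∈ℬ , x∈A₀ ← block-containing x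
    with y , y∉A₀ ← ∣p∣<n⇒∃∉ A₀ (subst (_< v) (sym (blockSize A₀∈ℬ)) v>k)
    with x≢y ← ∈∉⇒≢ A₀ x∈A₀ y∉A₀
    with A₁ , A₁∈ℬ , x∈A₁ , y∈A₁ ← block-through x y x≢y
    = begin
    replication ℬ x                          ≡⟨ replication-G x ⟨
    count (λ C → lookup C x) G              ≡⟨ count-split (λ C → lookup C x) (λ C → lookup C y) G ⟩
    count x∧y G + count x∧¬y G              ≡⟨ cong (count x∧y G +_) (count-translate A₁∈ℬ x∧¬y ¬x∧y flip-both) ⟩
    count x∧y G + count ¬x∧y G              ≡⟨ cong (count x∧y G +_) (count-translate A₀∈ℬ x∧y ¬x∧y flip-x) ⟨
    count x∧y G + count x∧y G               ≡⟨ cong₂ _+_ (pairs-G x y x≢y) (pairs-G x y x≢y) ⟩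
    lam + lam                                ∎
    where
    open ≡-Reasoning
    x∧y x∧¬y ¬x∧y : Subset v → Bool
    x∧y  C = lookup C x ∧ lookup C y
    x∧¬y C = lookup C x ∧ not (lookup C y)
    ¬x∧y C = not (lookup C x) ∧ lookup C y
    flip-both : ∀ C → x∧¬y (A₁ Δ C) ≡ ¬x∧y C
    flip-both C = cong₂ _∧_ (lookup-Δ-inside A₁ C x∈A₁)
      (trans (cong not (lookup-Δ-inside A₁ C y∈A₁)) (not-involutive (lookup C y)))
    flip-x : ∀ C → x∧y (A₀ Δ C) ≡ ¬x∧y C
    flip-x C = cong₂ _∧_ (lookup-Δ-inside A₀ C x∈A₀) (lookup-Δ-outside A₀ C y∉A₀)

symmetric-parameters : ∀ {v k lam b} → 1 ≤ lam → suc b ≡ lam + lam + (lam + lam) →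
  (lam + lam) * k + lam ≡ lam + lam + v * lam → v * (lam + lam) ≡ b * k →
  b ≡ v × v + 1 ≡ 4 * lam × k ≡ 2 * lam
symmetric-parameters {v} {k} {lam} {b} lam≥1 b+1≡4λ 2λk+λ≡2λ+vλ 2λv≡bk = b≡v , v+1≡4λ , k≡2λ
  where
  open ≡-Reasoning
  v+1≡2k : v + 1 ≡ 2 * k
  v+1≡2k = sym (+-cancelʳ-≡ 1 (2 * k) (v + 1) (*-cancelʳ-≡ _ _ lam {{>-nonZero lam≥1}} (begin
    (2 * k + 1) * lam                 ≡⟨ shape₁ k lam ⟩
    (lam + lam) * k + lam             ≡⟨ 2λk+λ≡2λ+vλ ⟩
    lam + lam + v * lam               ≡⟨ shape₂ v lam ⟩
    (v + 1 + 1) * lam                 ∎)))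
    where
    shape₁ : ∀ k l → (2 * k + 1) * l ≡ (l + l) * k + l
    shape₁ = solve-∀
    shape₂ : ∀ v l → l + l + v * l ≡ (v + 1 + 1) * l
    shape₂ = solve-∀
  k≡2λ : k ≡ 2 * lam
  k≡2λ = +-cancelˡ-≡ (v * (lam + lam)) k (2 * lam) (begin
    v * (lam + lam) + k               ≡⟨ cong (_+ k) 2λv≡bk ⟩
    b * k + k                         ≡⟨ +-comm (b * k) k ⟩
    suc b * k                         ≡⟨ cong (_* k) b+1≡4λ ⟩
    (lam + lam + (lam + lam)) * k     ≡⟨ shape₁ lam k ⟩
    (lam + lam) * (2 * k)             ≡⟨ cong ((lam + lam) *_) v+1≡2k ⟨
    (lam + lam) * (v + 1)             ≡⟨ shape₂ lam v ⟩
    v * (lam + lam) + 2 * lam         ∎)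
    where
    shape₁ : ∀ l k → (l + l + (l + l)) * k ≡ (l + l) * (2 * k)
    shape₁ = solve-∀
    shape₂ : ∀ l v → (l + l) * (v + 1) ≡ v * (l + l) + 2 * l
    shape₂ = solve-∀
  v+1≡4λ : v + 1 ≡ 4 * lam
  v+1≡4λ = trans v+1≡2k (trans (cong (2 *_) k≡2λ) (sym (*-assoc 2 2 lam)))
  b≡v : b ≡ v
  b≡v = suc-injective (begin
    suc b                   ≡⟨ b+1≡4λ ⟩
    lam + lam + (lam + lam) ≡⟨ four-λ lam ⟩
    4 * lam                 ≡⟨ v+1≡4λ ⟨
    v + 1                   ≡⟨ +-comm v 1 ⟩
    suc v                   ∎)
    where
    four-λ : ∀ l → l + l + (l + l) ≡ 4 * l
    four-λ = solve-∀

lemma1 : (v k lam : ℕ) (ℬ : List (Subset v)) →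
    1 ≤ lam →
    IsSimpleBIBD v k lam ℬ →
    ClosedUnderΔ ℬ →
    IsSymmetric ℬ × (v + 1 ≡ 4 * lam) × (k ≡ 2 * lam)
lemma1 v k lam ℬ lam≥1 bibd closed =
  symmetric-parameters lam≥1
    (trans (|G|≡2r x₀) (cong₂ _+_ r₀≡2λ r₀≡2λ))
    (subst (λ r → r * k + lam ≡ r + v * lam) r₀≡2λ (replication-identity x₀))
    (replication-constant replication≡2λ)
  where
  open IsSimpleBIBD bibd using (v>k)
  open BIBD bibd
  open GroupDesign lam≥1 bibd closed
  x₀ : Fin v
  x₀ = fromℕ< (≤-<-trans z≤n v>k)
  r₀≡2λ : replication ℬ x₀ ≡ lam + lam
  r₀≡2λ = replication≡2λ x₀
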